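{- Let $\mathcal M=(M,\mathcal S)$ be a model of $\mathsf{RCA}_0+\mathsf{I}\Sigma^0_2$, let $\Psi$ be a $\Sigma^0_1$ partial function $M^2\to M$, and let $B\subseteq M$ be $\Pi^0_2$. Then the family $\{\Psi_e : e\in B \text{ and } \Psi_e \text{ is total}\}$ is weakly represented.
   Context: A $\Sigma^0_n$ / $\Pi^0_n$ formula or set is one that is $\Sigma_n$ / $\Pi_n$ using finitely many set parameters from $\mathcal S$. $\mathsf{I}\Sigma^0_2$ is induction for $\Sigma^0_2$ formulas. For a partial function $\Psi: M^2\to M$ with $\Sigma^0_1$ graph, $\Psi_e(x)=\Psi(e,x)$. A family $\mathcal F$ of total functions $M\to M$ is weakly represented if there is a $\Sigma^0_1$ partial function $\Theta:M^2\to M$ with $\mathcal F=\{\Theta_e : \Theta_e \text{ is total}\}$. -}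

module Defs where

open import Data.Nat using (ℕ; zero; suc)
open import Data.Product using (Σ; _×_; _,_)
open import Data.Sum using (_⊎_)
open import Data.Empty using (⊥)
open import Relation.Binary.PropositionalEquality using (_≡_)

-- Deep embedding of the first-order part of the language of
-- second-order arithmetic, with free set variables (set parameters).
-- Number variables and set variables are both indexed by ℕ; number
-- variables use de Bruijn indices (a quantifier binds index 0).

infixl 7 _*ₜ_
infixl 6 _+ₜ_

data Term : Set where
  var   : ℕ → Term
  0ₜ 1ₜ : Term
  _+ₜ_ _*ₜ_ : Term → Term → Term

data Formula : Set where
  _≐_ _≺_ : Term → Term → Formula
  _∈̇_    : Term → ℕ → Formula
  ¬̇_     : Formula → Formula
  _∧̇_ _∨̇_ _⇒̇_ : Formula → Formula → Formula
  ∀̇_ ∃̇_  : Formula → Formula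
  ∀<_∙_ ∃<_∙_ : Term → Formula → Formula   -- ∀x<t φ , ∃x<t φ (t in outer scope)

data IsΔ0 : Formula → Set where
  eq  : ∀ {t s} → IsΔ0 (t ≐ s)
  lt  : ∀ {t s} → IsΔ0 (t ≺ s)
  mem : ∀ {t i} → IsΔ0 (t ∈̇ i)
  neg : ∀ {φ} → IsΔ0 φ → IsΔ0 (¬̇ φ)
  and : ∀ {φ ψ} → IsΔ0 φ → IsΔ0 ψ → IsΔ0 (φ ∧̇ ψ)
  or  : ∀ {φ ψ} → IsΔ0 φ → IsΔ0 ψ → IsΔ0 (φ ∨̇ ψ)
  imp : ∀ {φ ψ} → IsΔ0 φ → IsΔ0 ψ → IsΔ0 (φ ⇒̇ ψ)
  ball : ∀ {t φ} → IsΔ0 φ → IsΔ0 (∀< t ∙ φ)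
  bex  : ∀ {t φ} → IsΔ0 φ → IsΔ0 (∃< t ∙ φ)

data IsΣ : ℕ → Formula → Set
data IsΠ : ℕ → Formula → Set

data IsΣ where
  Σ-Δ0 : ∀ {φ} → IsΔ0 φ → IsΣ 0 φ
  Σ-Π  : ∀ {n φ} → IsΠ n φ → IsΣ (suc n) φ
  Σ-∃  : ∀ {n φ} → IsΣ (suc n) φ → IsΣ (suc n) (∃̇ φ)

data IsΠ where
  Π-Δ0 : ∀ {φ} → IsΔ0 φ → IsΠ 0 φ
  Π-Σ  : ∀ {n φ} → IsΣ n φ → IsΠ (suc n) φ
  Π-∀  : ∀ {n φ} → IsΠ (suc n) φ → IsΠ (suc n) (∀̇ φ)

-- L₂-structures (M, S): S is given as an index type of set codes with
-- a membership relation.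

record Structure : Set₁ where
  field
    M    : Set
    S    : Set
    _∈ₛ_ : M → S → Set
    𝟘 𝟙  : M
    _⊕_ _⊗_ : M → M → M
    _<ₘ_ : M → M → Set

_↔_ : Set → Set → Set
A ↔ B = (A → B) × (B → A)

module _ (𝓜 : Structure) where
  open Structure 𝓜

  _∷ᵥ_ : M → (ℕ → M) → ℕ → M
  (a ∷ᵥ ρ) zero    = a
  (a ∷ᵥ ρ) (suc i) = ρ i

  ⟦_⟧ : Term → (ℕ → M) → M
  ⟦ var i ⟧ ρ = ρ i
  ⟦ 0ₜ ⟧ ρ = 𝟘
  ⟦ 1ₜ ⟧ ρ = 𝟙
  ⟦ t +ₜ s ⟧ ρ = ⟦ t ⟧ ρ ⊕ ⟦ s ⟧ ρ
  ⟦ t *ₜ s ⟧ ρ = ⟦ t ⟧ ρ ⊗ ⟦ s ⟧ ρ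

  Sat : (ℕ → M) → (ℕ → S) → Formula → Set
  Sat ρ σ (t ≐ s) = ⟦ t ⟧ ρ ≡ ⟦ s ⟧ ρ
  Sat ρ σ (t ≺ s) = ⟦ t ⟧ ρ <ₘ ⟦ s ⟧ ρ
  Sat ρ σ (t ∈̇ i) = ⟦ t ⟧ ρ ∈ₛ σ i
  Sat ρ σ (¬̇ φ) = Sat ρ σ φ → ⊥
  Sat ρ σ (φ ∧̇ ψ) = Sat ρ σ φ × Sat ρ σ ψ
  Sat ρ σ (φ ∨̇ ψ) = Sat ρ σ φ ⊎ Sat ρ σ ψ
  Sat ρ σ (φ ⇒̇ ψ) = Sat ρ σ φ → Sat ρ σ ψ
  Sat ρ σ (∀̇ φ) = (a : M) → Sat (a ∷ᵥ ρ) σ φ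
  Sat ρ σ (∃̇ φ) = Σ M λ a → Sat (a ∷ᵥ ρ) σ φ
  Sat ρ σ (∀< t ∙ φ) = (a : M) → a <ₘ ⟦ t ⟧ ρ → Sat (a ∷ᵥ ρ) σ φ
  Sat ρ σ (∃< t ∙ φ) = Σ M λ a → (a <ₘ ⟦ t ⟧ ρ) × Sat (a ∷ᵥ ρ) σ φ

  record BasicAxioms : Set where
    field
      succ≢0   : ∀ m → (m ⊕ 𝟙) ≡ 𝟘 → ⊥
      succ-inj : ∀ m n → (m ⊕ 𝟙) ≡ (n ⊕ 𝟙) → m ≡ n
      +-0      : ∀ m → (m ⊕ 𝟘) ≡ m
      +-suc    : ∀ m n → (m ⊕ (n ⊕ 𝟙)) ≡ ((m ⊕ n) ⊕ 𝟙)
      *-0      : ∀ m → (m ⊗ 𝟘) ≡ 𝟘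
      *-suc    : ∀ m n → (m ⊗ (n ⊕ 𝟙)) ≡ ((m ⊗ n) ⊕ m)
      ≮0       : ∀ m → m <ₘ 𝟘 → ⊥
      <-suc    : ∀ m n → (m <ₘ (n ⊕ 𝟙)) ↔ ((m <ₘ n) ⊎ (m ≡ n))

  InductionΣ : ℕ → Set
  InductionΣ n = ∀ (φ : Formula) → IsΣ n φ → (ρ : ℕ → M) (σ : ℕ → S) →
    Sat (𝟘 ∷ᵥ ρ) σ φ →
    ((a : M) → Sat (a ∷ᵥ ρ) σ φ → Sat ((a ⊕ 𝟙) ∷ᵥ ρ) σ φ) →
    (a : M) → Sat (a ∷ᵥ ρ) σ φ

  Δ01Comprehension : Set
  Δ01Comprehension = ∀ (φ ψ : Formula) → IsΣ 1 φ → IsΠ 1 ψ →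
    (ρ : ℕ → M) (σ : ℕ → S) →
    ((a : M) → Sat (a ∷ᵥ ρ) σ φ ↔ Sat (a ∷ᵥ ρ) σ ψ) →
    Σ S λ X → (a : M) → (a ∈ₛ X) ↔ Sat (a ∷ᵥ ρ) σ φ

  record IsModelRCA0+IΣ02 : Set where
    field
      basic  : BasicAxioms
      indΣ1  : InductionΣ 1
      compΔ1 : Δ01Comprehension
      indΣ2  : InductionΣ 2

  IsΠ0Set : ℕ → (M → Set) → Set
  IsΠ0Set n B = Σ Formula λ φ → IsΠ n φ × Σ (ℕ → M) λ ρ → Σ (ℕ → S) λ σ →
    (a : M) → B a ↔ Sat (a ∷ᵥ ρ) σ φ

  -- Ψ : M² ⇀ M given by its graph  Ψ e x y  ("Ψ(e,x) = y");
  -- variables 0,1,2 of the defining formula are y, x, e.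
  record IsΣ01PartialFunction (Ψ : M → M → M → Set) : Set where
    field
      formula    : Formula
      isΣ1       : IsΣ 1 formula
      numParams  : ℕ → M
      setParams  : ℕ → S
      defines    : ∀ e x y →
        Ψ e x y ↔ Sat (y ∷ᵥ (x ∷ᵥ (e ∷ᵥ numParams))) setParams formula
      functional : ∀ e x y y′ → Ψ e x y → Ψ e x y′ → y ≡ y′

  Total : (M → M → M → Set) → M → Set
  Total Ψ e = (x : M) → Σ M λ y → Ψ e x y

  _computes_ : (M → M → M → Set) → M → (M → M) → Set
  (Ψ computes e) f = (x : M) → Ψ e x (f x)

  WeaklyRepresented : ((M → M) → Set) → Set₁
  WeaklyRepresented 𝓕 = Σ (M → M → M → Set) λ Θ →
    IsΣ01PartialFunction Θ ×
    ((f : M → M) → 𝓕 f ↔ (Σ M λ e → Total Θ e × (Θ computes e) f))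

-- Write B(e) as ∀ū ∃v̄ δ(e, ū, v̄) with δ bounded, and let Θ(e, x) = y iff
-- Ψ(e, x) = y and ∃b ∀ū < x ∃v̄ < b δ(e, ū, v̄).  This is a Σ⁰₁ condition, so
-- Θ is a Σ⁰₁ partial function, Θ_e ⊆ Ψ_e, and Θ_e is total iff Ψ_e is total
-- and ∀x ∃b ∀ū < x ∃v̄ < b δ.  The latter is equivalent to B(e): one direction
-- is immediate, the other is Σ⁰₀ collection, which Σ⁰₁ induction proves here
-- because the bounded condition is monotone in b.
module Submission where

open import Defs
open import Data.Empty using (⊥-elim)
open import Data.Nat using (ℕ; zero; suc)
open import Data.Product using (Σ; _×_; _,_; proj₁; proj₂)
open import Data.Product.Function.Dependent.Propositional using (congˡ)
open import Data.Product.Function.NonDependent.Propositional using (_×-⇔_)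
open import Data.Sum using (inj₁; inj₂)
open import Data.Sum.Function.Propositional using (_⊎-⇔_)
open import Function using (_∘_; id)
open import Function.Bundles using (_⇔_; mk⇔; Equivalence)
open import Function.Construct.Composition using (_⇔-∘_)
open import Function.Construct.Identity using (⇔-id)
open import Function.Construct.Symmetry using (⇔-sym)
open import Function.Related.Propositional using (K-reflexive)
open import Function.Related.TypeIsomorphisms using (→-cong-⇔; ¬-cong-⇔)
open import Level using (0ℓ)
open import Axiom.ExcludedMiddle using (ExcludedMiddle)
open import Relation.Binary.PropositionalEquality using (_≡_; refl; cong; cong₂; _≗_)

open Equivalence using (to; from)

fromPair : ∀ {A B} → A ↔ B → A ⇔ B
fromPair (f , g) = mk⇔ f g

toPair : ∀ {A B} → A ⇔ B → A ↔ B
toPair A⇔B = to A⇔B , from A⇔B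

Π-⇔ : ∀ {A : Set} {P Q : A → Set} → (∀ a → P a ⇔ Q a) → ((a : A) → P a) ⇔ ((a : A) → Q a)
Π-⇔ P⇔Q = mk⇔ (λ f a → to (P⇔Q a) (f a)) (λ g a → from (P⇔Q a) (g a))

ext : (ℕ → ℕ) → ℕ → ℕ
ext r zero    = zero
ext r (suc i) = suc (r i)

renameᵗ : (ℕ → ℕ) → Term → Term
renameᵗ r (var i)  = var (r i)
renameᵗ r 0ₜ       = 0ₜ
renameᵗ r 1ₜ       = 1ₜ
renameᵗ r (t +ₜ u) = renameᵗ r t +ₜ renameᵗ r u
renameᵗ r (t *ₜ u) = renameᵗ r t *ₜ renameᵗ r u

rename : (ℕ → ℕ) → (ℕ → ℕ) → Formula → Formula
rename r s (t ≐ u)    = renameᵗ r t ≐ renameᵗ r u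
rename r s (t ≺ u)    = renameᵗ r t ≺ renameᵗ r u
rename r s (t ∈̇ i)    = renameᵗ r t ∈̇ s i
rename r s (¬̇ φ)      = ¬̇ rename r s φ
rename r s (φ ∧̇ ψ)    = rename r s φ ∧̇ rename r s ψ
rename r s (φ ∨̇ ψ)    = rename r s φ ∨̇ rename r s ψ
rename r s (φ ⇒̇ ψ)    = rename r s φ ⇒̇ rename r s ψ
rename r s (∀̇ φ)      = ∀̇ rename (ext r) s φ
rename r s (∃̇ φ)      = ∃̇ rename (ext r) s φ
rename r s (∀< t ∙ φ) = ∀< renameᵗ r t ∙ rename (ext r) s φ
rename r s (∃< t ∙ φ) = ∃< renameᵗ r t ∙ rename (ext r) s φ

rename-isΔ0 : ∀ {φ} r s → IsΔ0 φ → IsΔ0 (rename r s φ)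
rename-isΔ0 r s eq        = eq
rename-isΔ0 r s lt        = lt
rename-isΔ0 r s mem       = mem
rename-isΔ0 r s (neg d)   = neg (rename-isΔ0 r s d)
rename-isΔ0 r s (and d e) = and (rename-isΔ0 r s d) (rename-isΔ0 r s e)
rename-isΔ0 r s (or d e)  = or (rename-isΔ0 r s d) (rename-isΔ0 r s e)
rename-isΔ0 r s (imp d e) = imp (rename-isΔ0 r s d) (rename-isΔ0 r s e)
rename-isΔ0 r s (ball d)  = ball (rename-isΔ0 (ext r) s d)
rename-isΔ0 r s (bex d)   = bex (rename-isΔ0 (ext r) s d)

rename-isΣ₁ : ∀ {φ} r s → IsΣ 1 φ → IsΣ 1 (rename r s φ)
rename-isΣ₁ r s (Σ-Π (Π-Δ0 d)) = Σ-Π (Π-Δ0 (rename-isΔ0 r s d))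
rename-isΣ₁ r s (Σ-∃ p)        = Σ-∃ (rename-isΣ₁ (ext r) s p)

double : ℕ → ℕ
double zero    = zero
double (suc i) = suc (suc (double i))

interleave : ∀ {A : Set} → (ℕ → A) → (ℕ → A) → ℕ → A
interleave f g zero          = f zero
interleave f g (suc zero)    = g zero
interleave f g (suc (suc i)) = interleave (f ∘ suc) (g ∘ suc) i

interleave-double : ∀ {A : Set} (f g : ℕ → A) → interleave f g ∘ double ≗ f
interleave-double f g zero    = refl
interleave-double f g (suc i) = interleave-double (f ∘ suc) (g ∘ suc) i

interleave-suc-double : ∀ {A : Set} (f g : ℕ → A) → interleave f g ∘ suc ∘ double ≗ g
interleave-suc-double f g zero    = refl
interleave-suc-double f g (suc i) = interleave-suc-double (f ∘ suc) (g ∘ suc) i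

-- A ∧ ∃ D as a prenex formula: D, whose variable 0 is the new witness, is
-- moved below the existential quantifiers of A.
_∧∃_ : ∀ {A} → IsΣ 1 A → Formula → Formula
Σ-∃ p ∧∃ D         = ∃̇ (p ∧∃ rename (ext suc) id D)
_∧∃_ {A} (Σ-Π _) D = ∃̇ (rename suc id A ∧̇ D)

∧∃-isΣ₁ : ∀ {A D} (p : IsΣ 1 A) → IsΔ0 D → IsΣ 1 (p ∧∃ D)
∧∃-isΣ₁ (Σ-∃ p)        d = Σ-∃ (∧∃-isΣ₁ p (rename-isΔ0 (ext suc) id d))
∧∃-isΣ₁ (Σ-Π (Π-Δ0 a)) d = Σ-∃ (Σ-Π (Π-Δ0 (and (rename-isΔ0 suc id a) d)))

thin₂ : ℕ → ℕ → ℕ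
thin₂ zero    = suc ∘ suc
thin₂ (suc k) = ext (thin₂ k)

-- Bounding the unbounded quantifiers of a prenex formula by two variables
-- inserted at index k: var k bounds the existential quantifiers and
-- var (suc k) the universal ones.
boundΣ₁ : ∀ {ψ} → ℕ → IsΣ 1 ψ → Formula
boundΣ₁ k (Σ-∃ p)     = ∃< var k ∙ boundΣ₁ (suc k) p
boundΣ₁ {ψ} k (Σ-Π _) = rename (thin₂ k) id ψ

boundΠ₂ : ∀ {φ} → ℕ → IsΠ 2 φ → Formula
boundΠ₂ k (Π-∀ q) = ∀< var (suc k) ∙ boundΠ₂ (suc k) q
boundΠ₂ k (Π-Σ p) = boundΣ₁ k p

boundΣ₁-isΔ0 : ∀ {ψ} k (p : IsΣ 1 ψ) → IsΔ0 (boundΣ₁ k p)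
boundΣ₁-isΔ0 k (Σ-∃ p)        = bex (boundΣ₁-isΔ0 (suc k) p)
boundΣ₁-isΔ0 k (Σ-Π (Π-Δ0 d)) = rename-isΔ0 (thin₂ k) id d

boundΠ₂-isΔ0 : ∀ {φ} k (q : IsΠ 2 φ) → IsΔ0 (boundΠ₂ k q)
boundΠ₂-isΔ0 k (Π-∀ q) = ball (boundΠ₂-isΔ0 (suc k) q)
boundΠ₂-isΔ0 k (Π-Σ p) = boundΣ₁-isΔ0 k p

module Semantics (𝓜 : Structure) where
  open Structure 𝓜

  infixr 5 _∷_
  _∷_ : M → (ℕ → M) → ℕ → M
  _∷_ = _∷ᵥ_ 𝓜

  ext-∷ : ∀ {r} {ρ ρ′ : ℕ → M} a → ρ′ ∘ r ≗ ρ → (a ∷ ρ′) ∘ ext r ≗ a ∷ ρ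
  ext-∷ a h zero    = refl
  ext-∷ a h (suc i) = h i

  ⟦renameᵗ⟧ : ∀ {r} {ρ ρ′ : ℕ → M} → ρ′ ∘ r ≗ ρ → ∀ t → ⟦_⟧ 𝓜 (renameᵗ r t) ρ′ ≡ ⟦_⟧ 𝓜 t ρ
  ⟦renameᵗ⟧ h (var i)  = h i
  ⟦renameᵗ⟧ h 0ₜ       = refl
  ⟦renameᵗ⟧ h 1ₜ       = refl
  ⟦renameᵗ⟧ h (t +ₜ u) = cong₂ _⊕_ (⟦renameᵗ⟧ h t) (⟦renameᵗ⟧ h u)
  ⟦renameᵗ⟧ h (t *ₜ u) = cong₂ _⊗_ (⟦renameᵗ⟧ h t) (⟦renameᵗ⟧ h u)

  Sat-rename : ∀ {r s} {ρ ρ′ : ℕ → M} {σ σ′ : ℕ → S} → ρ′ ∘ r ≗ ρ → σ′ ∘ s ≗ σ →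
    ∀ φ → Sat 𝓜 ρ′ σ′ (rename r s φ) ⇔ Sat 𝓜 ρ σ φ
  Sat-rename h hs (t ≐ u) = K-reflexive (cong₂ _≡_ (⟦renameᵗ⟧ h t) (⟦renameᵗ⟧ h u))
  Sat-rename h hs (t ≺ u) = K-reflexive (cong₂ _<ₘ_ (⟦renameᵗ⟧ h t) (⟦renameᵗ⟧ h u))
  Sat-rename h hs (t ∈̇ i) = K-reflexive (cong₂ _∈ₛ_ (⟦renameᵗ⟧ h t) (hs i))
  Sat-rename h hs (¬̇ φ)   = ¬-cong-⇔ (Sat-rename h hs φ)
  Sat-rename h hs (φ ∧̇ ψ) = Sat-rename h hs φ ×-⇔ Sat-rename h hs ψ
  Sat-rename h hs (φ ∨̇ ψ) = Sat-rename h hs φ ⊎-⇔ Sat-rename h hs ψ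
  Sat-rename h hs (φ ⇒̇ ψ) = →-cong-⇔ (Sat-rename h hs φ) (Sat-rename h hs ψ)
  Sat-rename h hs (∀̇ φ)   = Π-⇔ λ a → Sat-rename (ext-∷ a h) hs φ
  Sat-rename h hs (∃̇ φ)   = congˡ λ {a} → Sat-rename (ext-∷ a h) hs φ
  Sat-rename h hs (∀< t ∙ φ) =
    Π-⇔ λ a → →-cong-⇔ (K-reflexive (cong (a <ₘ_) (⟦renameᵗ⟧ h t))) (Sat-rename (ext-∷ a h) hs φ)
  Sat-rename h hs (∃< t ∙ φ) =
    congˡ λ {a} → K-reflexive (cong (a <ₘ_) (⟦renameᵗ⟧ h t)) ×-⇔ Sat-rename (ext-∷ a h) hs φ

  Sat-weaken : ∀ {ρ : ℕ → M} {σ : ℕ → S} a φ → Sat 𝓜 (a ∷ ρ) σ (rename suc id φ) ⇔ Sat 𝓜 ρ σ φ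
  Sat-weaken a = Sat-rename (λ _ → refl) (λ _ → refl)

  Sat-∧∃ : ∀ {A} (p : IsΣ 1 A) D (ρ : ℕ → M) (σ : ℕ → S) →
    Sat 𝓜 ρ σ (p ∧∃ D) ⇔ (Sat 𝓜 ρ σ A × Σ M λ b → Sat 𝓜 (b ∷ ρ) σ D)
  Sat-∧∃ {∃̇ A} (Σ-∃ p) D ρ σ = mk⇔
    (λ (a , s) → let (α , b , δ) = to (IH a) s in (a , α) , b , to (D′⇔D a b) δ)
    (λ ((a , α) , b , δ) → a , from (IH a) (α , b , from (D′⇔D a b) δ))
    where
    IH : ∀ a → Sat 𝓜 (a ∷ ρ) σ (p ∧∃ rename (ext suc) id D) ⇔
               (Sat 𝓜 (a ∷ ρ) σ A × Σ M λ b → Sat 𝓜 (b ∷ a ∷ ρ) σ (rename (ext suc) id D))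
    IH a = Sat-∧∃ p (rename (ext suc) id D) (a ∷ ρ) σ
    D′⇔D : ∀ a b → Sat 𝓜 (b ∷ a ∷ ρ) σ (rename (ext suc) id D) ⇔ Sat 𝓜 (b ∷ ρ) σ D
    D′⇔D a b = Sat-rename (ext-∷ b λ _ → refl) (λ _ → refl) D
  Sat-∧∃ {A} (Σ-Π _) D ρ σ = mk⇔
    (λ (b , α , δ) → to (Sat-weaken b A) α , b , δ)
    (λ (α , b , δ) → b , from (Sat-weaken b A) α , δ)

  -- The basic axioms do not make <ₘ transitive, so bounds are compared by
  -- inclusion of their initial segments.
  _⊑_ : M → M → Set
  b ⊑ b′ = ∀ v → v <ₘ b → v <ₘ b′

  module Bounding (σ : ℕ → S) where

    BoundedΣ₁ : ∀ {ψ} → M → (ℕ → M) → IsΣ 1 ψ → Set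
    BoundedΣ₁ b ρ (Σ-∃ p)     = Σ M λ a → a <ₘ b × BoundedΣ₁ b (a ∷ ρ) p
    BoundedΣ₁ {ψ} b ρ (Σ-Π _) = Sat 𝓜 ρ σ ψ

    BoundedΠ₂ : ∀ {φ} → M → M → (ℕ → M) → IsΠ 2 φ → Set
    BoundedΠ₂ x b ρ (Π-∀ q) = ∀ u → u <ₘ x → BoundedΠ₂ x b (u ∷ ρ) q
    BoundedΠ₂ x b ρ (Π-Σ p) = BoundedΣ₁ b ρ p

    Sat-boundΣ₁ : ∀ {ψ} (p : IsΣ 1 ψ) k {ρ ρ′ : ℕ → M} {b} → ρ′ ∘ thin₂ k ≗ ρ → ρ′ k ≡ b →
      Sat 𝓜 ρ′ σ (boundΣ₁ k p) ⇔ BoundedΣ₁ b ρ p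
    Sat-boundΣ₁ (Σ-∃ p) k h refl =
      congˡ λ {a} → ⇔-id _ ×-⇔ Sat-boundΣ₁ p (suc k) (ext-∷ a h) refl
    Sat-boundΣ₁ {ψ} (Σ-Π _) k h _ = Sat-rename h (λ _ → refl) ψ

    Sat-boundΠ₂ : ∀ {φ} (q : IsΠ 2 φ) k {ρ ρ′ : ℕ → M} {x b} → ρ′ ∘ thin₂ k ≗ ρ → ρ′ k ≡ b →
      ρ′ (suc k) ≡ x → Sat 𝓜 ρ′ σ (boundΠ₂ k q) ⇔ BoundedΠ₂ x b ρ q
    Sat-boundΠ₂ (Π-∀ q) k h hb refl =
      Π-⇔ λ u → →-cong-⇔ (⇔-id _) (Sat-boundΠ₂ q (suc k) (ext-∷ u h) hb refl)
    Sat-boundΠ₂ (Π-Σ p) k h hb _ = Sat-boundΣ₁ p k h hb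

    BoundedΣ₁-mono : ∀ {ψ} (p : IsΣ 1 ψ) {b b′ ρ} → b ⊑ b′ → BoundedΣ₁ b ρ p → BoundedΣ₁ b′ ρ p
    BoundedΣ₁-mono (Σ-∃ p) b⊑b′ (a , a<b , s) = a , b⊑b′ a a<b , BoundedΣ₁-mono p b⊑b′ s
    BoundedΣ₁-mono (Σ-Π _) b⊑b′ s = s

    BoundedΣ₁⇒Sat : ∀ {ψ} (p : IsΣ 1 ψ) {b ρ} → BoundedΣ₁ b ρ p → Sat 𝓜 ρ σ ψ
    BoundedΣ₁⇒Sat (Σ-∃ p) (a , _ , s) = a , BoundedΣ₁⇒Sat p s
    BoundedΣ₁⇒Sat (Σ-Π _) s = s

    BoundedΠ₂-monoʳ : ∀ {φ} (q : IsΠ 2 φ) {x b b′ ρ} → b ⊑ b′ → BoundedΠ₂ x b ρ q → BoundedΠ₂ x b′ ρ q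
    BoundedΠ₂-monoʳ (Π-∀ q) b⊑b′ f u u<x = BoundedΠ₂-monoʳ q b⊑b′ (f u u<x)
    BoundedΠ₂-monoʳ (Π-Σ p) b⊑b′ s = BoundedΣ₁-mono p b⊑b′ s

    BoundedΠ₂-antiˡ : ∀ {φ} (q : IsΠ 2 φ) {x x′ b ρ} → x ⊑ x′ → BoundedΠ₂ x′ b ρ q → BoundedΠ₂ x b ρ q
    BoundedΠ₂-antiˡ (Π-∀ q) x⊑x′ f u u<x = BoundedΠ₂-antiˡ q x⊑x′ (f u (x⊑x′ u u<x))
    BoundedΠ₂-antiˡ (Π-Σ p) x⊑x′ s = s

module Arithmetic (𝓜 : Structure) (basic : BasicAxioms 𝓜) (indΣ₁ : InductionΣ 𝓜 1)
                  (σ : ℕ → Structure.S 𝓜) where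
  open Structure 𝓜
  open BasicAxioms basic
  open Semantics 𝓜
  open Bounding σ

  Σ₁-induction : ∀ φ → IsΣ 1 φ → (ρ : ℕ → M) (P : M → Set) → (∀ a → Sat 𝓜 (a ∷ ρ) σ φ ⇔ P a) →
    P 𝟘 → (∀ a → P a → P (a ⊕ 𝟙)) → ∀ a → P a
  Σ₁-induction φ p ρ P φ⇔P base step a =
    to (φ⇔P a) (indΣ₁ φ p ρ σ (from (φ⇔P 𝟘) base)
                 (λ a → from (φ⇔P (a ⊕ 𝟙)) ∘ step a ∘ to (φ⇔P a)) a)

  Δ0-induction : ∀ φ → IsΔ0 φ → (ρ : ℕ → M) (P : M → Set) → (∀ a → Sat 𝓜 (a ∷ ρ) σ φ ⇔ P a) →
    P 𝟘 → (∀ a → P a → P (a ⊕ 𝟙)) → ∀ a → P a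
  Δ0-induction φ d = Σ₁-induction φ (Σ-Π (Π-Δ0 d))

  n<1+n : ∀ a → a <ₘ (a ⊕ 𝟙)
  n<1+n a = proj₂ (<-suc a a) (inj₂ refl)

  n⊑1+n : ∀ a → a ⊑ (a ⊕ 𝟙)
  n⊑1+n a v v<a = proj₂ (<-suc v a) (inj₁ v<a)

  0<1+n : ∀ a → 𝟘 <ₘ (a ⊕ 𝟙)
  0<1+n = Δ0-induction (0ₜ ≺ (var 0 +ₜ 1ₜ)) lt (λ _ → 𝟘) (λ a → 𝟘 <ₘ (a ⊕ 𝟙)) (λ _ → ⇔-id _)
    (n<1+n 𝟘) (λ a → n⊑1+n (a ⊕ 𝟙) 𝟘)

  +1-mono-< : ∀ a d → a <ₘ d → (a ⊕ 𝟙) <ₘ (d ⊕ 𝟙)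
  +1-mono-< a = Δ0-induction ((var 1 ≺ var 0) ⇒̇ ((var 1 +ₜ 1ₜ) ≺ (var 0 +ₜ 1ₜ))) (imp lt lt) (λ _ → a)
    (λ d → a <ₘ d → (a ⊕ 𝟙) <ₘ (d ⊕ 𝟙)) (λ _ → ⇔-id _)
    (λ a<0 → ⊥-elim (≮0 a a<0)) step
    where
    step : ∀ d → (a <ₘ d → (a ⊕ 𝟙) <ₘ (d ⊕ 𝟙)) → a <ₘ (d ⊕ 𝟙) → (a ⊕ 𝟙) <ₘ ((d ⊕ 𝟙) ⊕ 𝟙)
    step d IH a<d+1 with proj₁ (<-suc a d) a<d+1
    ... | inj₁ a<d  = n⊑1+n (d ⊕ 𝟙) (a ⊕ 𝟙) (IH a<d)
    ... | inj₂ refl = n<1+n (a ⊕ 𝟙)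

  ⊑-upperBound : ∀ b₁ b₂ → Σ M λ b → b₁ ⊑ b × b₂ ⊑ b
  ⊑-upperBound b₁ b₂ =
    let (b , b₁⊑b , b₂⊑b , _) = Σ₁-induction _ isΣ₁ (λ _ → b₁) Bounds (λ _ → ⇔-id _) base step b₂
    in b , b₁⊑b , b₂⊑b
    where
    Bounds : M → Set
    Bounds c = Σ M λ b → b₁ ⊑ b × c ⊑ b × c <ₘ b
    isΣ₁ : IsΣ 1 (∃̇ ((∀< var 2 ∙ (var 0 ≺ var 1)) ∧̇ ((∀< var 1 ∙ (var 0 ≺ var 1)) ∧̇ (var 1 ≺ var 0))))
    isΣ₁ = Σ-∃ (Σ-Π (Π-Δ0 (and (ball lt) (and (ball lt) lt))))
    base : Bounds 𝟘
    base = b₁ ⊕ 𝟙 , n⊑1+n b₁ , (λ v v<0 → ⊥-elim (≮0 v v<0)) , 0<1+n b₁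
    step : ∀ c → Bounds c → Bounds (c ⊕ 𝟙)
    step c (b , b₁⊑b , c⊑b , c<b) = b ⊕ 𝟙 , (λ v → n⊑1+n b v ∘ b₁⊑b v) , c+1⊑b+1 , +1-mono-< c b c<b
      where
      c+1⊑b+1 : (c ⊕ 𝟙) ⊑ (b ⊕ 𝟙)
      c+1⊑b+1 v v<c+1 with proj₁ (<-suc v c) v<c+1
      ... | inj₁ v<c  = n⊑1+n b v (c⊑b v v<c)
      ... | inj₂ refl = n⊑1+n b v c<b

  -- Σ⁰₁ induction on c of ∃b ∀u < c θ u b; by monotonicity an upper bound of
  -- the old witness and a witness for c serves for all u < c + 1.
  collection : ∀ {T} → IsΔ0 T → (ρ : ℕ → M) (θ : M → M → Set) →
    (∀ u b → Sat 𝓜 (u ∷ b ∷ ρ) σ T ⇔ θ u b) →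
    (∀ u {b b′} → b ⊑ b′ → θ u b → θ u b′) →
    (∀ u → Σ M (θ u)) →
    ∀ c → Σ M λ b → ∀ u → u <ₘ c → θ u b
  collection {T} d ρ θ T⇔θ mono total =
    Σ₁-induction (∃̇ (∀< var 1 ∙ rename (ext (ext suc)) id T))
      (Σ-∃ (Σ-Π (Π-Δ0 (ball (rename-isΔ0 (ext (ext suc)) id d))))) ρ Collected
      (λ c → congˡ λ {b} → Π-⇔ λ u → →-cong-⇔ (⇔-id _)
               (T⇔θ u b ⇔-∘ Sat-rename (ext-∷ u (ext-∷ b λ _ → refl)) (λ _ → refl) T))
      (𝟘 , λ u u<0 → ⊥-elim (≮0 u u<0))
      step
    where
    Collected : M → Set
    Collected c = Σ M λ b → ∀ u → u <ₘ c → θ u b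
    step : ∀ c → Collected c → Collected (c ⊕ 𝟙)
    step c (b₁ , θ<c) with total c
    ... | b₂ , θc with ⊑-upperBound b₁ b₂
    ... | b , b₁⊑b , b₂⊑b = b , θ<c+1
      where
      θ<c+1 : ∀ u → u <ₘ (c ⊕ 𝟙) → θ u b
      θ<c+1 u u<c+1 with proj₁ (<-suc u c) u<c+1
      ... | inj₁ u<c  = mono u b₁⊑b (θ<c u u<c)
      ... | inj₂ refl = mono c b₂⊑b θc

  Sat⇒BoundedΣ₁ : ∀ {ψ} (p : IsΣ 1 ψ) ρ → Sat 𝓜 ρ σ ψ → Σ M λ b → BoundedΣ₁ b ρ p
  Sat⇒BoundedΣ₁ (Σ-∃ p) ρ (a , s) =
    let (b′ , s′) = Sat⇒BoundedΣ₁ p (a ∷ ρ) s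
        (b , a+1⊑b , b′⊑b) = ⊑-upperBound (a ⊕ 𝟙) b′
    in b , a , a+1⊑b a (n<1+n a) , BoundedΣ₁-mono p b′⊑b s′
  Sat⇒BoundedΣ₁ (Σ-Π _) ρ s = 𝟘 , s

  Sat⇒BoundedΠ₂ : ∀ {φ} (q : IsΠ 2 φ) ρ → Sat 𝓜 ρ σ φ → ∀ x → Σ M λ b → BoundedΠ₂ x b ρ q
  Sat⇒BoundedΠ₂ (Π-Σ p) ρ s x = Sat⇒BoundedΣ₁ p ρ s
  Sat⇒BoundedΠ₂ (Π-∀ q) ρ s x =
    collection (boundΠ₂-isΔ0 1 q) (x ∷ ρ) (λ u b → BoundedΠ₂ x b (u ∷ ρ) q)
      (λ u b → Sat-boundΠ₂ q 1 (λ { zero → refl ; (suc i) → refl }) refl refl)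
      (λ u → BoundedΠ₂-monoʳ q)
      (λ u → Sat⇒BoundedΠ₂ q (u ∷ ρ) (s u) x)
      x

  BoundedΠ₂⇒Sat : ∀ {φ} (q : IsΠ 2 φ) ρ → (∀ x → Σ M λ b → BoundedΠ₂ x b ρ q) → Sat 𝓜 ρ σ φ
  BoundedΠ₂⇒Sat (Π-Σ p) ρ bounded = BoundedΣ₁⇒Sat p (proj₂ (bounded 𝟘))
  BoundedΠ₂⇒Sat (Π-∀ q) ρ bounded u = BoundedΠ₂⇒Sat q (u ∷ ρ) boundedᵤ
    where
    boundedᵤ : ∀ x → Σ M λ b → BoundedΠ₂ x b (u ∷ ρ) q
    boundedᵤ x =
      let (x′ , x⊑x′ , u+1⊑x′) = ⊑-upperBound x (u ⊕ 𝟙)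
          (b , s) = bounded x′
      in b , BoundedΠ₂-antiˡ q x⊑x′ (s u (u+1⊑x′ u (n<1+n u)))

  Sat⇔∀∃BoundedΠ₂ : ∀ {φ} (q : IsΠ 2 φ) ρ → Sat 𝓜 ρ σ φ ⇔ (∀ x → Σ M λ b → BoundedΠ₂ x b ρ q)
  Sat⇔∀∃BoundedΠ₂ q ρ = mk⇔ (Sat⇒BoundedΠ₂ q ρ) (BoundedΠ₂⇒Sat q ρ)

module Restriction (𝓜 : Structure) where
  open Structure 𝓜
  open Semantics 𝓜

  Restrict : (M → M → M → Set) → (M → M → Set) → M → M → M → Set
  Restrict Ψ C e x y = Ψ e x y × C e x

  Restrict-total-computes : ∀ Ψ C e f →
    (Total 𝓜 (Restrict Ψ C) e × _computes_ 𝓜 (Restrict Ψ C) e f) ⇔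
    ((∀ x → C e x) × Total 𝓜 Ψ e × _computes_ 𝓜 Ψ e f)
  Restrict-total-computes Ψ C e f = mk⇔
    (λ (total , computes) →
      (λ x → proj₂ (proj₂ (total x))) ,
      (λ x → proj₁ (total x) , proj₁ (proj₂ (total x))) ,
      (λ x → proj₁ (computes x)))
    (λ (C-all , total , computes) →
      (λ x → proj₁ (total x) , proj₂ (total x) , C-all x) ,
      (λ x → computes x , C-all x))

  restrict-isΣ₀₁ : ∀ {Ψ} → IsΣ01PartialFunction 𝓜 Ψ → ∀ {D} → IsΔ0 D → (ρ : ℕ → M) (σ : ℕ → S) →
    IsΣ01PartialFunction 𝓜 (Restrict Ψ λ e x → Σ M λ b → Sat 𝓜 (b ∷ x ∷ e ∷ ρ) σ D)
  restrict-isΣ₀₁ {Ψ} isΨ {D} d ρ σ = record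
    { formula    = ψ′ ∧∃ D′
    ; isΣ1       = ∧∃-isΣ₁ ψ′ (rename-isΔ0 rD (suc ∘ double) d)
    ; numParams  = ρ′
    ; setParams  = σ′
    ; defines    = λ e x y → toPair
        (⇔-sym (Sat-∧∃ ψ′ D′ (y ∷ x ∷ e ∷ ρ′) σ′) ⇔-∘ (Ψ⇔ψ′ e x y ×-⇔ congˡ (⇔-sym (D′⇔D e x y _))))
    ; functional = λ e x y y′ (Ψy , _) (Ψy′ , _) → P.functional e x y y′ Ψy Ψy′
    }
    where
    module P = IsΣ01PartialFunction isΨ
    ρ′ : ℕ → M
    ρ′ = interleave P.numParams ρ
    σ′ : ℕ → S
    σ′ = interleave P.setParams σ
    ψ′ : IsΣ 1 (rename (ext (ext (ext double))) double P.formula)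
    ψ′ = rename-isΣ₁ (ext (ext (ext double))) double P.isΣ1
    -- D lives in the context b, x, e, ρ and D′ in b, y, x, e, ρ′.
    rD : ℕ → ℕ
    rD = ext (suc ∘ ext (ext (suc ∘ double)))
    D′ : Formula
    D′ = rename rD (suc ∘ double) D
    Ψ⇔ψ′ : ∀ e x y → Ψ e x y ⇔ Sat 𝓜 (y ∷ x ∷ e ∷ ρ′) σ′ (rename (ext (ext (ext double))) double P.formula)
    Ψ⇔ψ′ e x y =
      ⇔-sym (Sat-rename (ext-∷ y (ext-∷ x (ext-∷ e (interleave-double P.numParams ρ))))
                        (interleave-double P.setParams σ) P.formula)
      ⇔-∘ fromPair (P.defines e x y)
    D′⇔D : ∀ e x y b → Sat 𝓜 (b ∷ y ∷ x ∷ e ∷ ρ′) σ′ D′ ⇔ Sat 𝓜 (b ∷ x ∷ e ∷ ρ) σ D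
    D′⇔D e x y b = Sat-rename (ext-∷ b (ext-∷ x (ext-∷ e (interleave-suc-double P.numParams ρ))))
                              (interleave-suc-double P.setParams σ) D

mainTheorem3 : ExcludedMiddle 0ℓ →
    (𝓜 : Structure) → IsModelRCA0+IΣ02 𝓜 →
    (Ψ : Structure.M 𝓜 → Structure.M 𝓜 → Structure.M 𝓜 → Set) →
    IsΣ01PartialFunction 𝓜 Ψ →
    (B : Structure.M 𝓜 → Set) → IsΠ0Set 𝓜 2 B →
    WeaklyRepresented 𝓜 (λ f → Σ (Structure.M 𝓜) λ e →
      B e × Total 𝓜 Ψ e × _computes_ 𝓜 Ψ e f)
mainTheorem3 _ 𝓜 model Ψ isΨ B (φ , q , ρ , σ , B⇔φ) =
  Restrict Ψ Bounded , restrict-isΣ₀₁ isΨ (boundΠ₂-isΔ0 0 q) ρ σ , represents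
  where
  open Structure 𝓜
  open IsModelRCA0+IΣ02 model using (basic; indΣ1)
  open Semantics 𝓜
  open Bounding σ using (Sat-boundΠ₂)
  open Arithmetic 𝓜 basic indΣ1 σ
  open Restriction 𝓜

  Bounded : M → M → Set
  Bounded e x = Σ M λ b → Sat 𝓜 (b ∷ x ∷ e ∷ ρ) σ (boundΠ₂ 0 q)

  B⇔∀Bounded : ∀ e → B e ⇔ (∀ x → Bounded e x)
  B⇔∀Bounded e =
    (Π-⇔ (λ x → congˡ (⇔-sym (Sat-boundΠ₂ q 0 (λ _ → refl) refl refl)))
     ⇔-∘ Sat⇔∀∃BoundedΠ₂ q (e ∷ ρ))
    ⇔-∘ fromPair (B⇔φ e)

  represents : ∀ f → (Σ M λ e → B e × Total 𝓜 Ψ e × _computes_ 𝓜 Ψ e f) ↔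
                     (Σ M λ e → Total 𝓜 (Restrict Ψ Bounded) e × _computes_ 𝓜 (Restrict Ψ Bounded) e f)
  represents f = toPair (congˡ λ {e} →
    ⇔-sym (Restrict-total-computes Ψ Bounded e f) ⇔-∘ (B⇔∀Bounded e ×-⇔ ⇔-id _))
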